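{- For every positive integer $n$: (i) $cs(K_1 \Box K_n)=s(K_1 \Box K_n)=\left\lceil\frac{n}{2}\right\rceil$; (ii) $cs(K_2 \Box K_n)=s(K_2 \Box K_n)=n$.
   Context: For a connected graph $G$ and $X\subseteq V(G)$, $G[X]$ denotes the subgraph induced by $X$. A set $S\subseteq V(G)$ is a safe set if for every component $C$ of $G[S]$ and every component $D$ of $G-S$ such that some edge joins $C$ and $D$, we have $|C|\ge |D|$. If moreover $G[S]$ is connected, $S$ is a connected safe set. The safe number $s(G)$ is the minimum size of a safe set of $G$, and the connected safe number $cs(G)$ is the minimum size of a connected safe set of $G$. $K_m \Box K_n$ is the Cartesian product of complete graphs: vertex set $[m]\times[n]$, with $(i,j)$ and $(i',j')$ adjacent iff either $i=i'$ and $j\neq j'$, or $j=j'$ and $i\ne i'$. -}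

module Defs where

open import Data.Nat using (ℕ; _≤_; _*_)
open import Data.Fin using (Fin; quotient; remainder)
open import Data.Fin.Subset using (Subset; _∈_; _∉_; _⊆_; ∁; ∣_∣; Nonempty)
open import Data.Product using (_×_; ∃; ∃-syntax; _,_)
open import Data.Sum using (_⊎_)
open import Relation.Binary.PropositionalEquality using (_≡_; _≢_)

record Graph (N : ℕ) : Set₁ where
  field
    Adj : Fin N → Fin N → Set
open Graph public

module _ {N : ℕ} (G : Graph N) where

  data Reach (X : Subset N) : Fin N → Fin N → Set where
    here : ∀ {u} → u ∈ X → Reach X u u
    step : ∀ {u v w} → Reach X u v → Adj G v w → w ∈ X → Reach X u w

  Connected : Subset N → Set
  Connected X = Nonempty X × (∀ u v → u ∈ X → v ∈ X → Reach X u v)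

  Component : Subset N → Subset N → Set
  Component X C = C ⊆ X × Connected C
                × (∀ u v → u ∈ C → Reach X u v → v ∈ C)

  Joined : Subset N → Subset N → Set
  Joined C D = ∃[ u ] ∃[ v ] (u ∈ C × v ∈ D × Adj G u v)

  IsSafe : Subset N → Set
  IsSafe S = Nonempty S ×
    (∀ C D → Component S C → Component (∁ S) D → Joined C D → ∣ D ∣ ≤ ∣ C ∣)

  IsConnectedSafe : Subset N → Set
  IsConnectedSafe S = IsSafe S × Connected S

  SafeNumberIs : ℕ → Set
  SafeNumberIs k = (∃[ S ] (IsSafe S × ∣ S ∣ ≡ k))
                 × (∀ S → IsSafe S → k ≤ ∣ S ∣)

  ConnectedSafeNumberIs : ℕ → Set
  ConnectedSafeNumberIs k = (∃[ S ] (IsConnectedSafe S × ∣ S ∣ ≡ k))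
                          × (∀ S → IsConnectedSafe S → k ≤ ∣ S ∣)

-- K_m □ K_n, with vertex (i , j) ∈ [m] × [n] encoded as Fin (m * n)
-- via the standard bijection (quotient = i, remainder = j).
KK : (m n : ℕ) → Graph (m * n)
Adj (KK m n) x y =
    (quotient {m} n x ≡ quotient {m} n y × remainder {m} n x ≢ remainder {m} n y)
  ⊎ (remainder {m} n x ≡ remainder {m} n y × quotient {m} n x ≢ quotient {m} n y)

-- A connected set S with |V ∖ S| ≤ |S| is safe, since its only component is S itself.
-- Conversely a safe set S forces |V ∖ S| ≤ |S| in both graphs: in K₁ □ Kₙ = Kₙ both S and
-- its complement are cliques joined by an edge; in K₂ □ Kₙ a set with fewer than n vertices
-- misses a whole column, which makes the complement connected and adjacent to every
-- component of S. So s = cs is the least k with 2k ≥ |V|.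
module Submission where

open import Defs
open import Data.Nat using (ℕ; suc; _≤_; _<_; _+_; _*_; _∸_; z≤n; s≤s; ⌊_/2⌋; ⌈_/2⌉)
open import Data.Nat.Properties
  using ( ≤-trans; ≤-reflexive; +-monoˡ-≤; +-monoʳ-≤; ∸-monoˡ-≤; +-suc; +-identityʳ
        ; *-identityˡ; m≤n+m∸n; m+n∸m≡n; ⌊n/2⌋-mono; ⌈n/2⌉-mono; n≡⌊n+n/2⌋; n≡⌈n+n/2⌉
        ; ⌊n/2⌋≤⌈n/2⌉; ⌊n/2⌋+⌈n/2⌉≡n; ⌈n/2⌉≤n; module ≤-Reasoning )
open import Data.Vec using ([]; _∷_; _++_; splitAt; tabulate; here; there)
open import Data.Vec.Properties using (lookup∘tabulate; []=⇒lookup; lookup⇒[]=)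
open import Data.Fin using (Fin; zero; suc; quotient; remainder; combine; _≟_; _↑ˡ_; _↑ʳ_)
open import Data.Fin.Properties using (remQuot-combine; combine-remQuot; any?; all?)
open import Data.Fin.Subset using (Subset; _∈_; _∉_; _⊆_; ∁; ∣_∣; Nonempty; inside; outside; ⊤; ⊥; _∩_)
open import Data.Fin.Subset.Properties
  using ( _∈?_; nonempty?; Empty-unique; drop-there; ∉⊥; ∣⊥∣≡0; ∣⊤∣≡n; ∣p∣≤∣x∷p∣
        ; p⊆q⇒∣p∣≤∣q∣; ∣∁p∣≡n∸∣p∣; x∉p⇒x∈∁p; x∈∁p⇒x∉p; x∈p∩q⁺; x∈p∩q⁻ )
open import Data.Product using (_×_; ∃-syntax; _,_; proj₁; proj₂)
open import Data.Sum using (_⊎_; inj₁; inj₂; [_,_]′)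
import Data.Sum as Sum
open import Data.Empty using (⊥-elim)
open import Relation.Nullary using (¬_; yes; no; does)
open import Relation.Nullary.Decidable using (dec-true)
open import Relation.Binary.PropositionalEquality using (_≡_; _≢_; refl; sym; trans; cong; cong₂; subst; subst₂; module ≡-Reasoning)

module _ {N : ℕ} (G : Graph N) where

  reach-target : ∀ {X u v} → Reach G X u v → v ∈ X
  reach-target (here v∈X)     = v∈X
  reach-target (step _ _ v∈X) = v∈X

  reach-trans : ∀ {X u v w} → Reach G X u v → Reach G X v w → Reach G X u w
  reach-trans u⇝v (here _)           = u⇝v
  reach-trans u⇝v (step v⇝w adj w∈X) = step (reach-trans u⇝v v⇝w) adj w∈X

  ≡⊎Adj⇒reach : ∀ {X u v} → u ∈ X → v ∈ X → u ≡ v ⊎ Adj G u v → Reach G X u v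
  ≡⊎Adj⇒reach u∈X _   (inj₁ refl) = here u∈X
  ≡⊎Adj⇒reach u∈X v∈X (inj₂ adj)  = step (here u∈X) adj v∈X

  ≡⊎Adj⇒Adj : ∀ {S u v} → u ∈ S → v ∈ ∁ S → u ≡ v ⊎ Adj G u v → Adj G u v
  ≡⊎Adj⇒Adj u∈S v∈∁S (inj₁ refl) = ⊥-elim (x∈∁p⇒x∉p v∈∁S u∈S)
  ≡⊎Adj⇒Adj _   _    (inj₂ adj)  = adj

  clique⇒connected : ∀ {X} → Nonempty X → (∀ u v → u ∈ X → v ∈ X → u ≡ v ⊎ Adj G u v) →
                     Connected G X
  clique⇒connected inhabited clique =
    inhabited , λ u v u∈X v∈X → ≡⊎Adj⇒reach u∈X v∈X (clique u v u∈X v∈X)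

  connected⇒component : ∀ {X} → Connected G X → Component G X X
  connected⇒component X-connected = (λ x∈X → x∈X) , X-connected , λ _ _ _ → reach-target

  connected⇒⊆component : ∀ {S C} → Connected G S → Component G S C → S ⊆ C
  connected⇒⊆component (_ , S-paths) (C⊆S , ((c , c∈C) , _) , C-closed) s∈S =
    C-closed _ _ c∈C (S-paths _ _ (C⊆S c∈C) s∈S)

  connected⇒connectedSafe : ∀ {S} → Connected G S → ∣ ∁ S ∣ ≤ ∣ S ∣ → IsConnectedSafe G S
  connected⇒connectedSafe {S} S-connected ∣∁S∣≤∣S∣ =
    (proj₁ S-connected , bound) , S-connected
    where
    bound : ∀ C D → Component G S C → Component G (∁ S) D → Joined G C D → ∣ D ∣ ≤ ∣ C ∣
    bound C D C-comp D-comp _ = begin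
      ∣ D ∣   ≤⟨ p⊆q⇒∣p∣≤∣q∣ (proj₁ D-comp) ⟩
      ∣ ∁ S ∣ ≤⟨ ∣∁S∣≤∣S∣ ⟩
      ∣ S ∣   ≤⟨ p⊆q⇒∣p∣≤∣q∣ (connected⇒⊆component S-connected C-comp) ⟩
      ∣ C ∣   ∎
      where open ≤-Reasoning

  safe⇒∣∁S∣≤∣S∣ : ∀ {S C} → IsSafe G S → Component G S C → Connected G (∁ S) →
                  Joined G C (∁ S) → ∣ ∁ S ∣ ≤ ∣ S ∣
  safe⇒∣∁S∣≤∣S∣ (_ , safe) C-comp ∁S-connected joined =
    ≤-trans (safe _ _ C-comp (connected⇒component ∁S-connected) joined)
            (p⊆q⇒∣p∣≤∣q∣ (proj₁ C-comp))

  complete-safe⇒∣∁S∣≤∣S∣ : (∀ u v → u ≡ v ⊎ Adj G u v) → ∀ {S} → IsSafe G S → ∣ ∁ S ∣ ≤ ∣ S ∣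
  complete-safe⇒∣∁S∣≤∣S∣ complete {S} safe@((u , u∈S) , _) with nonempty? (∁ S)
  ... | no ∁S-empty =
    subst (_≤ ∣ S ∣) (sym (trans (cong ∣_∣ (Empty-unique ∁S-empty)) (∣⊥∣≡0 N))) z≤n
  ... | yes ∁S-inhabited@(v , v∈∁S) =
    safe⇒∣∁S∣≤∣S∣ safe (connected⇒component (connected (u , u∈S)))
      (connected ∁S-inhabited) (u , v , u∈S , v∈∁S , ≡⊎Adj⇒Adj u∈S v∈∁S (complete u v))
    where
    connected : ∀ {X} → Nonempty X → Connected G X
    connected inhabited = clique⇒connected inhabited (λ u v _ _ → complete u v)

  safeNumbersFromBounds : ∀ {k} → (∃[ S ] (IsConnectedSafe G S × ∣ S ∣ ≡ k)) →
                (∀ S → IsSafe G S → k ≤ ∣ S ∣) →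
                ConnectedSafeNumberIs G k × SafeNumberIs G k
  safeNumbersFromBounds (S₀ , S₀-connectedSafe , ∣S₀∣≡k) lower =
    ((S₀ , S₀-connectedSafe , ∣S₀∣≡k) , λ S S-connectedSafe → lower S (proj₁ S-connectedSafe))
    , ((S₀ , proj₁ S₀-connectedSafe , ∣S₀∣≡k) , lower)

∣p∣>0⇒nonempty : ∀ {n} (p : Subset n) → 0 < ∣ p ∣ → Nonempty p
∣p∣>0⇒nonempty (inside ∷ p)  _ = zero , here
∣p∣>0⇒nonempty (outside ∷ p) ∣p∣>0
  with x , x∈p ← ∣p∣>0⇒nonempty p ∣p∣>0 = suc x , there x∈p

module _ {n : ℕ} where

  ∣∁p∣≤∣p∣⇒n≤∣p∣+∣p∣ : (p : Subset n) → ∣ ∁ p ∣ ≤ ∣ p ∣ → n ≤ ∣ p ∣ + ∣ p ∣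
  ∣∁p∣≤∣p∣⇒n≤∣p∣+∣p∣ p ∣∁p∣≤∣p∣ = begin
    n                   ≤⟨ m≤n+m∸n n ∣ p ∣ ⟩
    ∣ p ∣ + (n ∸ ∣ p ∣) ≡⟨ cong (∣ p ∣ +_) (∣∁p∣≡n∸∣p∣ p) ⟨
    ∣ p ∣ + ∣ ∁ p ∣     ≤⟨ +-monoʳ-≤ ∣ p ∣ ∣∁p∣≤∣p∣ ⟩
    ∣ p ∣ + ∣ p ∣       ∎
    where open ≤-Reasoning

  n≤∣p∣+∣p∣⇒∣∁p∣≤∣p∣ : (p : Subset n) → n ≤ ∣ p ∣ + ∣ p ∣ → ∣ ∁ p ∣ ≤ ∣ p ∣
  n≤∣p∣+∣p∣⇒∣∁p∣≤∣p∣ p n≤2∣p∣ = begin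
    ∣ ∁ p ∣                   ≡⟨ ∣∁p∣≡n∸∣p∣ p ⟩
    n ∸ ∣ p ∣                 ≤⟨ ∸-monoˡ-≤ ∣ p ∣ n≤2∣p∣ ⟩
    ∣ p ∣ + ∣ p ∣ ∸ ∣ p ∣     ≡⟨ m+n∸m≡n ∣ p ∣ ∣ p ∣ ⟩
    ∣ p ∣                     ∎
    where open ≤-Reasoning

common-gap-suc : ∀ {n s t} {p q : Subset n} →
                 ∃[ k ] (k ∉ p × k ∉ q) → ∃[ k ] (k ∉ s ∷ p × k ∉ t ∷ q)
common-gap-suc (k , k∉p , k∉q) = suc k , (λ k∈ → k∉p (drop-there k∈)) , (λ k∈ → k∉q (drop-there k∈))

common-gap-or-cover : ∀ {n} (p q : Subset n) → (∃[ k ] (k ∉ p × k ∉ q)) ⊎ n ≤ ∣ p ∣ + ∣ q ∣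
common-gap-or-cover []            []            = inj₂ z≤n
common-gap-or-cover (outside ∷ p) (outside ∷ q) = inj₁ (zero , (λ ()) , (λ ()))
common-gap-or-cover (inside ∷ p)  (t ∷ q)       =
  Sum.map common-gap-suc (λ n≤ → s≤s (≤-trans n≤ (+-monoʳ-≤ ∣ p ∣ (∣p∣≤∣x∷p∣ t q))))
    (common-gap-or-cover p q)
common-gap-or-cover (outside ∷ p) (inside ∷ q)  =
  Sum.map common-gap-suc (λ n≤ → ≤-trans (s≤s n≤) (≤-reflexive (sym (+-suc ∣ p ∣ ∣ q ∣))))
    (common-gap-or-cover p q)

∣++∣ : ∀ {m n} (p : Subset m) (q : Subset n) → ∣ p ++ q ∣ ≡ ∣ p ∣ + ∣ q ∣
∣++∣ []            q = refl
∣++∣ (inside ∷ p)  q = cong suc (∣++∣ p q)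
∣++∣ (outside ∷ p) q = ∣++∣ p q

∈-++⁻ˡ : ∀ {m n} {p : Subset m} {q : Subset n} {i} → i ↑ˡ n ∈ p ++ q → i ∈ p
∈-++⁻ˡ {p = _ ∷ _} {i = zero}  here      = here
∈-++⁻ˡ {p = _ ∷ _} {i = suc i} (there i∈) = there (∈-++⁻ˡ i∈)

∈-++⁻ʳ : ∀ {m n} {p : Subset m} {q : Subset n} {i} → m ↑ʳ i ∈ p ++ q → i ∈ q
∈-++⁻ʳ {p = []}    i∈ = i∈
∈-++⁻ʳ {p = _ ∷ _} i∈ = ∈-++⁻ʳ (drop-there i∈)

initialSegment : ∀ {k N} → k ≤ N → Subset N
initialSegment z≤n       = ⊥
initialSegment (s≤s k≤N) = inside ∷ initialSegment k≤N

∣initialSegment∣ : ∀ {k N} (k≤N : k ≤ N) → ∣ initialSegment k≤N ∣ ≡ k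
∣initialSegment∣ {N = N} z≤n = ∣⊥∣≡0 N
∣initialSegment∣ (s≤s k≤N)   = cong suc (∣initialSegment∣ k≤N)

fin2-cover : ∀ {i j : Fin 2} → i ≢ j → ∀ k → k ≡ i ⊎ k ≡ j
fin2-cover {zero}     {zero}     i≢j _          = ⊥-elim (i≢j refl)
fin2-cover {zero}     {suc zero} _   zero       = inj₁ refl
fin2-cover {zero}     {suc zero} _   (suc zero) = inj₂ refl
fin2-cover {suc zero} {zero}     _   zero       = inj₂ refl
fin2-cover {suc zero} {zero}     _   (suc zero) = inj₁ refl
fin2-cover {suc zero} {suc zero} i≢j _          = ⊥-elim (i≢j refl)

n≤k+k⇒⌈n/2⌉≤k : ∀ {n k} → n ≤ k + k → ⌈ n /2⌉ ≤ k
n≤k+k⇒⌈n/2⌉≤k {n} {k} n≤2k = subst (⌈ n /2⌉ ≤_) (sym (n≡⌈n+n/2⌉ k)) (⌈n/2⌉-mono n≤2k)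

n≤⌈n/2⌉+⌈n/2⌉ : ∀ n → n ≤ ⌈ n /2⌉ + ⌈ n /2⌉
n≤⌈n/2⌉+⌈n/2⌉ n =
  subst (_≤ ⌈ n /2⌉ + ⌈ n /2⌉) (⌊n/2⌋+⌈n/2⌉≡n n) (+-monoˡ-≤ ⌈ n /2⌉ (⌊n/2⌋≤⌈n/2⌉ n))

2*n≤k+k⇒n≤k : ∀ {n k} → 2 * n ≤ k + k → n ≤ k
2*n≤k+k⇒n≤k {n} {k} 2n≤2k = begin
  n           ≡⟨ n≡⌊n+n/2⌋ n ⟩
  ⌊ n + n /2⌋ ≤⟨ ⌊n/2⌋-mono (subst (_≤ k + k) (cong (n +_) (+-identityʳ n)) 2n≤2k) ⟩
  ⌊ k + k /2⌋ ≡⟨ n≡⌊n+n/2⌋ k ⟨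
  k           ∎
  where open ≤-Reasoning

module Rook (m n : ℕ) where

  vertex : Fin m → Fin n → Fin (m * n)
  vertex = combine

  row : Fin (m * n) → Fin m
  row = quotient n

  column : Fin (m * n) → Fin n
  column = remainder {m} n

  row-vertex : ∀ (i : Fin m) (j : Fin n) → row (vertex i j) ≡ i
  row-vertex i j = cong proj₁ (remQuot-combine i j)

  column-vertex : ∀ (i : Fin m) (j : Fin n) → column (vertex i j) ≡ j
  column-vertex i j = cong proj₂ (remQuot-combine i j)

  vertex-row-column : ∀ x → vertex (row x) (column x) ≡ x
  vertex-row-column x = combine-remQuot {m} n x

  coordinates-injective : ∀ {u v} → row u ≡ row v → column u ≡ column v → u ≡ v
  coordinates-injective {u} {v} same-row same-column = begin
    u                          ≡⟨ vertex-row-column u ⟨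
    vertex (row u) (column u)  ≡⟨ cong₂ vertex same-row same-column ⟩
    vertex (row v) (column v)  ≡⟨ vertex-row-column v ⟩
    v                          ∎
    where open ≡-Reasoning

  same-row⇒≡⊎Adj : ∀ {u v} → row u ≡ row v → u ≡ v ⊎ Adj (KK m n) u v
  same-row⇒≡⊎Adj {u} {v} same-row with column u ≟ column v
  ... | yes same-column = inj₁ (coordinates-injective same-row same-column)
  ... | no  columns≢    = inj₂ (inj₁ (same-row , columns≢))

  same-column⇒≡⊎Adj : ∀ {u v} → column u ≡ column v → u ≡ v ⊎ Adj (KK m n) u v
  same-column⇒≡⊎Adj {u} {v} same-column with row u ≟ row v
  ... | yes same-row = inj₁ (coordinates-injective same-row same-column)
  ... | no  rows≢    = inj₂ (inj₂ (same-column , rows≢))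

  rowSet : Fin m → Subset (m * n)
  rowSet i = tabulate (λ x → does (row x ≟ i))

  ∈rowSet⁺ : ∀ {x i} → row x ≡ i → x ∈ rowSet i
  ∈rowSet⁺ {x} {i} row≡i =
    lookup⇒[]= x (rowSet i) (trans (lookup∘tabulate _ x) (dec-true (row x ≟ i) row≡i))

  ∈rowSet⁻ : ∀ {x i} → x ∈ rowSet i → row x ≡ i
  ∈rowSet⁻ {x} {i} x∈ with row x ≟ i | trans (sym (lookup∘tabulate _ x)) ([]=⇒lookup x∈)
  ... | yes row≡i | _ = row≡i
  ... | no  _     | ()

  module _ {S : Subset (m * n)}
           (column-edges-absent : ∀ {u v} → u ∈ S → v ∈ S → column u ≡ column v → row u ≡ row v)
           where

    reach-preserves-row : ∀ {u v} → Reach (KK m n) S u v → row u ≡ row v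
    reach-preserves-row (here _)                           = refl
    reach-preserves-row (step u⇝v (inj₁ (same-row , _)) _) =
      trans (reach-preserves-row u⇝v) same-row
    reach-preserves-row (step u⇝v (inj₂ (same-column , _)) w∈S) =
      trans (reach-preserves-row u⇝v)
            (column-edges-absent (reach-target (KK m n) u⇝v) w∈S same-column)

    rowSlice-component : ∀ {i} → Nonempty (S ∩ rowSet i) → Component (KK m n) S (S ∩ rowSet i)
    rowSlice-component {i} inhabited =
      (λ x∈ → proj₁ (∈slice⁻ x∈)) , clique⇒connected (KK m n) inhabited clique , closed
      where
      ∈slice⁻ : ∀ {x} → x ∈ S ∩ rowSet i → x ∈ S × row x ≡ i
      ∈slice⁻ x∈ with x∈S , x∈row ← x∈p∩q⁻ S (rowSet i) x∈ = x∈S , ∈rowSet⁻ x∈row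

      clique : ∀ u v → u ∈ S ∩ rowSet i → v ∈ S ∩ rowSet i → u ≡ v ⊎ Adj (KK m n) u v
      clique _ _ u∈ v∈ = same-row⇒≡⊎Adj (trans (proj₂ (∈slice⁻ u∈)) (sym (proj₂ (∈slice⁻ v∈))))

      closed : ∀ u v → u ∈ S ∩ rowSet i → Reach (KK m n) S u v → v ∈ S ∩ rowSet i
      closed _ _ u∈ u⇝v =
        x∈p∩q⁺ ( reach-target (KK m n) u⇝v
               , ∈rowSet⁺ (trans (sym (reach-preserves-row u⇝v)) (proj₂ (∈slice⁻ u∈))) )

  column⊆⇒connected : ∀ {X k} → (∀ i → vertex i k ∈ X) → Nonempty X → Connected (KK m n) X
  column⊆⇒connected {X} {k} column⊆X inhabited = inhabited , path
    where
    -- u → (row u, k) → (row v, k) → v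
    path : ∀ u v → u ∈ X → v ∈ X → Reach (KK m n) X u v
    path u v u∈X v∈X =
      reach-trans (KK m n)
        (≡⊎Adj⇒reach (KK m n) u∈X (column⊆X (row u)) (same-row⇒≡⊎Adj (sym (row-vertex _ k))))
        (reach-trans (KK m n)
          (≡⊎Adj⇒reach (KK m n) (column⊆X (row u)) (column⊆X (row v))
            (same-column⇒≡⊎Adj (trans (column-vertex _ k) (sym (column-vertex _ k)))))
          (≡⊎Adj⇒reach (KK m n) (column⊆X (row v)) v∈X (same-row⇒≡⊎Adj (row-vertex _ k))))

  column⊆∁⇒joined : ∀ {S C k s} → (∀ i → vertex i k ∈ ∁ S) → C ⊆ S → s ∈ C →
                    Joined (KK m n) C (∁ S)
  column⊆∁⇒joined {k = k} {s} column⊆∁S C⊆S s∈C =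
    s , vertex (row s) k , s∈C , column⊆∁S (row s) ,
    ≡⊎Adj⇒Adj (KK m n) (C⊆S s∈C) (column⊆∁S (row s))
      (same-row⇒≡⊎Adj (sym (row-vertex (row s) k)))

module _ (n : ℕ) where
  open Rook 1 n

  KK1-complete : ∀ u v → u ≡ v ⊎ Adj (KK 1 n) u v
  KK1-complete u v = same-row⇒≡⊎Adj (Fin1-unique (row u) (row v))
    where
    Fin1-unique : (i j : Fin 1) → i ≡ j
    Fin1-unique zero zero = refl

  KK1-safe⇒⌈n/2⌉≤∣S∣ : ∀ S → IsSafe (KK 1 n) S → ⌈ n /2⌉ ≤ ∣ S ∣
  KK1-safe⇒⌈n/2⌉≤∣S∣ S safe =
    n≤k+k⇒⌈n/2⌉≤k (subst (_≤ ∣ S ∣ + ∣ S ∣) (*-identityˡ n)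
      (∣∁p∣≤∣p∣⇒n≤∣p∣+∣p∣ S (complete-safe⇒∣∁S∣≤∣S∣ (KK 1 n) KK1-complete safe)))

  KK1-connectedSafe : 1 ≤ n → ∃[ S ] (IsConnectedSafe (KK 1 n) S × ∣ S ∣ ≡ ⌈ n /2⌉)
  KK1-connectedSafe 1≤n = S₀ , connected⇒connectedSafe (KK 1 n) S₀-connected ∣∁S₀∣≤∣S₀∣ , ∣S₀∣≡
    where
    ⌈n/2⌉≤1*n : ⌈ n /2⌉ ≤ 1 * n
    ⌈n/2⌉≤1*n = subst (⌈ n /2⌉ ≤_) (sym (*-identityˡ n)) (⌈n/2⌉≤n n)

    S₀ : Subset (1 * n)
    S₀ = initialSegment ⌈n/2⌉≤1*n

    ∣S₀∣≡ : ∣ S₀ ∣ ≡ ⌈ n /2⌉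
    ∣S₀∣≡ = ∣initialSegment∣ ⌈n/2⌉≤1*n

    ⌈n/2⌉>0 : ∀ {n} → 0 < n → 0 < ⌈ n /2⌉
    ⌈n/2⌉>0 (s≤s _) = s≤s z≤n

    S₀-connected : Connected (KK 1 n) S₀
    S₀-connected = clique⇒connected (KK 1 n)
      (∣p∣>0⇒nonempty S₀ (subst (0 <_) (sym ∣S₀∣≡) (⌈n/2⌉>0 1≤n))) (λ u v _ _ → KK1-complete u v)

    ∣∁S₀∣≤∣S₀∣ : ∣ ∁ S₀ ∣ ≤ ∣ S₀ ∣
    ∣∁S₀∣≤∣S₀∣ = n≤∣p∣+∣p∣⇒∣∁p∣≤∣p∣ S₀
      (subst₂ _≤_ (sym (*-identityˡ n)) (cong (λ k → k + k) (sym ∣S₀∣≡)) (n≤⌈n/2⌉+⌈n/2⌉ n))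

module _ (n : ℕ) where
  open Rook 2 n

  -- A subset of Fin (2 * n) = Fin (n + (n + 0)) is literally the first row followed by the second.
  column-gap-or-n≤∣S∣ : (S : Subset (2 * n)) → (∃[ k ] (∀ i → vertex i k ∈ ∁ S)) ⊎ n ≤ ∣ S ∣
  column-gap-or-n≤∣S∣ S with splitAt n S
  ... | p , q₀ , refl with splitAt n q₀
  ... | q , [] , refl = Sum.map gap-column n≤∣S∣ (common-gap-or-cover p q)
    where
    gap-column : ∃[ k ] (k ∉ p × k ∉ q) → ∃[ k ] (∀ i → vertex i k ∈ ∁ (p ++ (q ++ [])))
    gap-column (k , k∉p , k∉q) = k , λ where
      zero       → x∉p⇒x∈∁p (λ k∈ → k∉p (∈-++⁻ˡ k∈))
      (suc zero) → x∉p⇒x∈∁p (λ k∈ → k∉q (∈-++⁻ˡ (∈-++⁻ʳ {p = p} k∈)))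
      (suc (suc ()))

    n≤∣S∣ : n ≤ ∣ p ∣ + ∣ q ∣ → n ≤ ∣ p ++ (q ++ []) ∣
    n≤∣S∣ n≤∣p∣+∣q∣ = subst (n ≤_)
      (sym (trans (∣++∣ p (q ++ [])) (cong (∣ p ∣ +_) (trans (∣++∣ q []) (+-identityʳ ∣ q ∣)))))
      n≤∣p∣+∣q∣

  no-full-column⇒same-row : ∀ {S} → ¬ (∃[ k ] (∀ i → vertex i k ∈ S)) →
                            ∀ {u v} → u ∈ S → v ∈ S → column u ≡ column v → row u ≡ row v
  no-full-column⇒same-row {S} no-full {u} {v} u∈S v∈S same-column with row u ≟ row v
  ... | yes same-row = same-row
  ... | no  rows≢    = ⊥-elim (no-full (column u , λ i → [ at u∈S refl , at v∈S (sym same-column) ]′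
                                                         (fin2-cover rows≢ i)))
    where
    at : ∀ {x i} → x ∈ S → column x ≡ column u → i ≡ row x → vertex i (column u) ∈ S
    at {x} {i} x∈S column≡ i≡row =
      subst (_∈ S) (sym (coordinates-injective (trans (row-vertex i _) i≡row)
                                               (trans (column-vertex i _) (sym column≡)))) x∈S

  ∈⇒component : ∀ {S s} → s ∈ S → ∃[ C ] (Component (KK 2 n) S C × s ∈ C)
  ∈⇒component {S} {s} s∈S with any? (λ k → all? (λ i → vertex i k ∈? S))
  ... | yes (_ , column⊆S) =
    S , connected⇒component (KK 2 n) (column⊆⇒connected column⊆S (s , s∈S)) , s∈S
  ... | no no-full =
    S ∩ rowSet (row s) , rowSlice-component (no-full-column⇒same-row no-full) (s , s∈slice) , s∈slice
    where
    s∈slice : s ∈ S ∩ rowSet (row s)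
    s∈slice = x∈p∩q⁺ (s∈S , ∈rowSet⁺ refl)

  KK2-safe⇒n≤∣S∣ : ∀ S → IsSafe (KK 2 n) S → n ≤ ∣ S ∣
  KK2-safe⇒n≤∣S∣ S safe@((s , s∈S) , _) with column-gap-or-n≤∣S∣ S
  ... | inj₂ n≤∣S∣ = n≤∣S∣
  ... | inj₁ (k , column⊆∁S)
    with C , C-comp , s∈C ← ∈⇒component s∈S =
    2*n≤k+k⇒n≤k (∣∁p∣≤∣p∣⇒n≤∣p∣+∣p∣ S
      (safe⇒∣∁S∣≤∣S∣ (KK 2 n) safe C-comp
        (column⊆⇒connected column⊆∁S (_ , column⊆∁S zero))
        (column⊆∁⇒joined column⊆∁S (proj₁ C-comp) s∈C)))

  firstRow : Subset (2 * n)
  firstRow = ⊤ {n} ++ ⊥ {n + 0}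

  ∣firstRow∣ : ∣ firstRow ∣ ≡ n
  ∣firstRow∣ = begin
    ∣ ⊤ {n} ++ ⊥ {n + 0} ∣  ≡⟨ ∣++∣ (⊤ {n}) (⊥ {n + 0}) ⟩
    ∣ ⊤ {n} ∣ + ∣ ⊥ {n + 0} ∣ ≡⟨ cong₂ _+_ (∣⊤∣≡n n) (∣⊥∣≡0 (n + 0)) ⟩
    n + 0                     ≡⟨ +-identityʳ n ⟩
    n                         ∎
    where open ≡-Reasoning

  ∈firstRow⇒row≡0 : ∀ {x} → x ∈ firstRow → row x ≡ zero
  ∈firstRow⇒row≡0 {x} x∈ =
    in-row-zero (row x) (column x) (subst (_∈ firstRow) (sym (vertex-row-column x)) x∈)
    where
    in-row-zero : ∀ i j → vertex i j ∈ firstRow → i ≡ zero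
    in-row-zero zero       _ _  = refl
    in-row-zero (suc zero) _ j∈ = ⊥-elim (∉⊥ (∈-++⁻ʳ {p = ⊤ {n}} j∈))

  KK2-connectedSafe : 1 ≤ n → ∃[ S ] (IsConnectedSafe (KK 2 n) S × ∣ S ∣ ≡ n)
  KK2-connectedSafe 1≤n =
    firstRow , connected⇒connectedSafe (KK 2 n) connected ∣∁firstRow∣≤∣firstRow∣ , ∣firstRow∣
    where
    connected : Connected (KK 2 n) firstRow
    connected = clique⇒connected (KK 2 n)
      (∣p∣>0⇒nonempty firstRow (subst (0 <_) (sym ∣firstRow∣) 1≤n))
      (λ u v u∈ v∈ → same-row⇒≡⊎Adj (trans (∈firstRow⇒row≡0 u∈) (sym (∈firstRow⇒row≡0 v∈))))

    ∣∁firstRow∣≤∣firstRow∣ : ∣ ∁ firstRow ∣ ≤ ∣ firstRow ∣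
    ∣∁firstRow∣≤∣firstRow∣ = n≤∣p∣+∣p∣⇒∣∁p∣≤∣p∣ firstRow
      (subst (λ k → 2 * n ≤ k + k) (sym ∣firstRow∣) (≤-reflexive (cong (n +_) (+-identityʳ n))))

proposition2p1 : (n : ℕ) → 1 ≤ n →
    (ConnectedSafeNumberIs (KK 1 n) ⌈ n /2⌉ × SafeNumberIs (KK 1 n) ⌈ n /2⌉)
    × (ConnectedSafeNumberIs (KK 2 n) n × SafeNumberIs (KK 2 n) n)
proposition2p1 n 1≤n =
  safeNumbersFromBounds (KK 1 n) (KK1-connectedSafe n 1≤n) (KK1-safe⇒⌈n/2⌉≤∣S∣ n) ,
  safeNumbersFromBounds (KK 2 n) (KK2-connectedSafe n 1≤n) (KK2-safe⇒n≤∣S∣ n)
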